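{- Let $\lambda=(\lambda_1,\dots,\lambda_n)$ and $\mu=(\mu_1,\dots,\mu_n)$ be vectors of rational numbers forming a two-row Gelfand--Tsetlin pattern $G$ with top row $\lambda$ and bottom row $\mu$, i.e. $\lambda_1\ge\mu_1\ge\lambda_2\ge\mu_2\ge\dots\ge\lambda_n\ge\mu_n$. Then for every rational $t$ with $|\mu|\le t\le|\lambda|$ there exists $\nu=(\nu_1,\dots,\nu_n)$ with $|\nu|=t$ such that the three-row array $G'$ with rows $\lambda$ (top), $\nu$ (middle), $\mu$ (bottom) is a Gelfand--Tsetlin pattern (i.e. $\lambda_j\ge\nu_j\ge\lambda_{j+1}$ and $\nu_j\ge\mu_j\ge\nu_{j+1}$ for all applicable $j$), and such that for all $i,j$, whenever the entries $\lambda_i$ and $\mu_j$ belong to the same tile of $G$, they belong to the same tile of $G'$.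
   Context: For a vector $\mathbf{v}$, $|\mathbf{v}|$ is the sum of its entries. In a Gelfand--Tsetlin pattern $(x^i_j)$ (rows $i=1,\dots,m$ with row $m$ on top, satisfying $x^{i+1}_j\ge x^i_j\ge x^{i+1}_{j+1}$), positions $(i,j)$ and $(i+1,j)$, as well as $(i,j)$ and $(i+1,j+1)$, are adjacent. The tiling of a pattern is the finest partition of its set of positions into tiles such that adjacent positions carrying equal entries lie in the same tile. -}

module Defs where

open import Data.Nat using (ℕ; zero; suc)
open import Data.Fin using (Fin; zero; suc; toℕ)
open import Data.Rational using (ℚ; 0ℚ; _+_; _≤_)
open import Data.Product using (_×_; _,_)
import Data.Product
open import Data.Sum using (_⊎_)
open import Relation.Binary.PropositionalEquality using (_≡_)
open import Relation.Binary.Construct.Closure.Equivalence using (EqClosure)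

∣_∣ᵥ : ∀ {n} → (Fin n → ℚ) → ℚ
∣_∣ᵥ {zero} v = 0ℚ
∣_∣ᵥ {suc n} v = v zero + ∣ (λ j → v (suc j)) ∣ᵥ

-- A (rectangular) array with m rows of length n; x i j is the entry x^{i+1}_{j+1}.
-- Row index zero is the bottom row, row (m-1) is the top row.
Array : ℕ → ℕ → Set
Array m n = Fin m → Fin n → ℚ

Pos : ℕ → ℕ → Set
Pos m n = Fin m × Fin n

IsGT : ∀ {m n} → Array m n → Set
IsGT {m} {n} x =
  ∀ (i i' : Fin m) (j j' : Fin n) → toℕ i' ≡ suc (toℕ i) →
    (toℕ j' ≡ toℕ j → x i j ≤ x i' j') ×
    (toℕ j' ≡ suc (toℕ j) → x i' j' ≤ x i j)

Adjacent : ∀ {m n} → Pos m n → Pos m n → Set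
Adjacent (i , j) (i' , j') =
  toℕ i' ≡ suc (toℕ i) × (toℕ j' ≡ toℕ j ⊎ toℕ j' ≡ suc (toℕ j))

EqAdjacent : ∀ {m n} → Array m n → Pos m n → Pos m n → Set
EqAdjacent x p q = Adjacent p q × x (Data.Product.proj₁ p) (Data.Product.proj₂ p) ≡ x (Data.Product.proj₁ q) (Data.Product.proj₂ q)

-- same tile: the finest partition in which adjacent equal positions share a tile,
-- i.e. the equivalence closure of EqAdjacent
SameTile : ∀ {m n} → Array m n → Pos m n → Pos m n → Set
SameTile x = EqClosure (EqAdjacent x)

twoRow : ∀ {n} → (Fin n → ℚ) → (Fin n → ℚ) → Array 2 n
twoRow top bot zero = bot
twoRow top bot (suc zero) = top

threeRow : ∀ {n} → (Fin n → ℚ) → (Fin n → ℚ) → (Fin n → ℚ) → Array 3 n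
threeRow top mid bot zero = bot
threeRow top mid bot (suc zero) = mid
threeRow top mid bot (suc (suc zero)) = top

module Submission where

-- A middle row ν keeps the three-row array
-- Gelfand–Tsetlin as soon as bot ≤ ν ≤ top coordinatewise, because the
-- two-row condition already gives top (j+1) ≤ bot j.  Among such rows we pick
-- a *saturated* one: for consecutive coordinates j, j+1, either ν j = bot j
-- or ν (j+1) = top (j+1).  A saturated row with any prescribed sum
-- |bot| ≤ t ≤ |top| is built greedily from the left: keep ν j = bot j while
-- the remaining coordinates can still absorb the rest of t, then set one
-- coordinate to the exact remainder and all later ones to top.
-- Saturation is precisely what keeps tiles together: if bot j = top j', the
-- entries are joined in the new pattern by a path of two equal adjacent steps
-- through the middle row (through ν j when j' = j, and through ν j or ν (j+1)
-- when j' = j+1).  Since a tile is the equivalence closure of such steps,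
-- folding this over the closure proves that every tile of G lies in a tile
-- of G'.

open import Defs
open import Data.Nat using (ℕ; zero; suc)
open import Data.Nat.Properties using (suc-injective)
open import Data.Fin using (Fin; zero; suc; toℕ)
open import Data.Fin.Properties using (toℕ-injective)
open import Data.Vec.Functional using (_∷_; tail)
open import Data.Rational using (ℚ; _≤_; _+_; _-_; -_)
open import Data.Rational.Properties using (≤-refl; ≤-trans; ≤-antisym; <⇒≤; ≰⇒>; _≤?_; +-monoˡ-≤)
open import Data.Rational.Solver using (module +-*-Solver)
open import Data.Product using (Σ; _×_; _,_; proj₁; proj₂)
open import Data.Sum using (_⊎_; inj₁; inj₂)
open import Relation.Nullary using (yes; no)
open import Relation.Binary.PropositionalEquality using (_≡_; refl; sym; trans; cong; subst)
open import Relation.Binary.Construct.Closure.ReflexiveTransitive using (ε; _◅_)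
open import Relation.Binary.Construct.Closure.Symmetric using (fwd)
import Relation.Binary.Construct.Closure.Equivalence as EqClosure

module Cancellation where
  open +-*-Solver

  +-sub-cancelˡ : ∀ a b → (a + b) - a ≡ b
  +-sub-cancelˡ = solve 2 (λ a b → (a :+ b) :- a := b) refl

  +-sub-cancelʳ : ∀ a b → (a + b) - b ≡ a
  +-sub-cancelʳ = solve 2 (λ a b → (a :+ b) :- b := a) refl

  sub-+-cancel : ∀ a b → (a - b) + b ≡ a
  sub-+-cancel = solve 2 (λ a b → (a :- b) :+ b := a) refl

  +-sub-cancel : ∀ a b → a + (b - a) ≡ b
  +-sub-cancel = solve 2 (λ a b → a :+ (b :- a) := b) refl

open Cancellation

≤-sub-transpose : ∀ a b c → a + b ≤ c → b ≤ c - a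
≤-sub-transpose a b c a+b≤c =
  subst (_≤ c - a) (+-sub-cancelˡ a b) (+-monoˡ-≤ (- a) a+b≤c)

sub-≤-transpose : ∀ a b c → c ≤ a + b → c - b ≤ a
sub-≤-transpose a b c c≤a+b =
  subst (c - b ≤_) (+-sub-cancelʳ a b) (+-monoˡ-≤ (- b) c≤a+b)

sub-swap-≤ : ∀ a b c → a ≤ c - b → b ≤ c - a
sub-swap-≤ a b c a≤c-b = ≤-sub-transpose a b c
  (subst (a + b ≤_) (sub-+-cancel c b) (+-monoˡ-≤ b a≤c-b))

Between : ∀ {n} → (bot top mid : Fin n → ℚ) → Set
Between bot top mid = ∀ k → bot k ≤ mid k × mid k ≤ top k

Saturated : ∀ {n} → (bot top mid : Fin n → ℚ) → Set
Saturated {n} bot top mid =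
  ∀ (k k' : Fin n) → toℕ k' ≡ suc (toℕ k) → mid k ≡ bot k ⊎ mid k' ≡ top k'

saturated-∷-bot : ∀ {n} (bot top : Fin (suc n) → ℚ) (mid : Fin n → ℚ) →
  Saturated (tail bot) (tail top) mid → Saturated bot top (bot zero ∷ mid)
saturated-∷-bot bot top mid sat zero    _        _ = inj₁ refl
saturated-∷-bot bot top mid sat (suc k) (suc k') e = sat k k' (suc-injective e)

saturated-∷-top : ∀ {n} (bot top : Fin (suc n) → ℚ) (x : ℚ) →
  Saturated bot top (x ∷ tail top)
saturated-∷-top bot top x _ (suc k') _ = inj₂ refl

interpolate : ∀ n (bot top : Fin n → ℚ) → (∀ k → bot k ≤ top k) →
  ∀ t → ∣ bot ∣ᵥ ≤ t → t ≤ ∣ top ∣ᵥ →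
  Σ (Fin n → ℚ) λ mid → ∣ mid ∣ᵥ ≡ t × Between bot top mid × Saturated bot top mid
interpolate zero bot top bot≤top t lo hi = (λ ()) , ≤-antisym lo hi , (λ ()) , (λ ())
interpolate (suc n) bot top bot≤top t lo hi with t - bot zero ≤? ∣ tail top ∣ᵥ
... | yes restFits =
  let (mid , sum , between , sat) =
        interpolate n (tail bot) (tail top) (λ k → bot≤top (suc k)) (t - bot zero)
          (≤-sub-transpose (bot zero) _ t lo) restFits
  in bot zero ∷ mid
   , trans (cong (bot zero +_) sum) (+-sub-cancel (bot zero) t)
   , (λ { zero → ≤-refl , bot≤top zero ; (suc k) → between k })
   , saturated-∷-bot bot top mid sat
... | no restOverflows =
  let rest = ∣ tail top ∣ᵥ
      bot≤head : bot zero ≤ t - rest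
      bot≤head = sub-swap-≤ rest (bot zero) t (<⇒≤ (≰⇒> restOverflows))
  in (t - rest) ∷ tail top
   , sub-+-cancel t rest
   , (λ { zero → bot≤head , sub-≤-transpose (top zero) rest t hi
        ; (suc k) → bot≤top (suc k) , ≤-refl })
   , saturated-∷-top bot top (t - rest)

module TwoRow {n} {top bot : Fin n → ℚ} (gt : IsGT (twoRow top bot)) where

  bot≤top : ∀ k → bot k ≤ top k
  bot≤top k = proj₁ (gt zero (suc zero) k k refl) refl

  nextTop≤bot : ∀ k k' → toℕ k' ≡ suc (toℕ k) → top k' ≤ bot k
  nextTop≤bot k k' = proj₂ (gt zero (suc zero) k k' refl)

threeRow-IsGT : ∀ {n} {top mid bot : Fin n → ℚ} →
  IsGT (twoRow top bot) → Between bot top mid → IsGT (threeRow top mid bot)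
threeRow-IsGT {mid = mid} {bot} gt between zero (suc zero) j j' _ =
  (λ e → subst (λ x → bot j ≤ mid x) (toℕ-injective (sym e)) (proj₁ (between j)))
  , (λ e → ≤-trans (proj₂ (between j')) (TwoRow.nextTop≤bot gt j j' e))
threeRow-IsGT {top = top} {mid} gt between (suc zero) (suc (suc zero)) j j' _ =
  (λ e → subst (λ x → mid j ≤ top x) (toℕ-injective (sym e)) (proj₂ (between j)))
  , (λ e → ≤-trans (TwoRow.nextTop≤bot gt j j' e) (proj₁ (between j)))
threeRow-IsGT gt between zero zero _ _ ()
threeRow-IsGT gt between zero (suc (suc zero)) _ _ ()
threeRow-IsGT gt between (suc zero) zero _ _ ()
threeRow-IsGT gt between (suc zero) (suc zero) _ _ ()
threeRow-IsGT gt between (suc (suc zero)) zero _ _ ()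
threeRow-IsGT gt between (suc (suc zero)) (suc zero) _ _ ()
threeRow-IsGT gt between (suc (suc zero)) (suc (suc zero)) _ _ ()

outerRows : ∀ {n} → Pos 2 n → Pos 3 n
outerRows (zero , j)     = zero , j
outerRows (suc zero , j) = suc (suc zero) , j

module Tiles {n} {top mid bot : Fin n → ℚ}
  (between : Between bot top mid) (sat : Saturated bot top mid) where

  tile-step : ∀ p q → EqAdjacent (twoRow top bot) p q →
    SameTile (threeRow top mid bot) (outerRows p) (outerRows q)
  tile-step (zero , j) (suc zero , j') ((_ , inj₁ j'≡j) , eq)
    with refl ← toℕ-injective j'≡j =
    fwd ((refl , inj₁ refl) , sym mid≡bot) ◅ fwd ((refl , inj₁ refl) , trans mid≡bot eq) ◅ ε
    where
      -- mid j is squeezed between bot j and top j = bot j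
      mid≡bot : mid j ≡ bot j
      mid≡bot = ≤-antisym (subst (mid j ≤_) (sym eq) (proj₂ (between j))) (proj₁ (between j))
  tile-step (zero , j) (suc zero , j') ((_ , inj₂ next) , eq) with sat j j' next
  ... | inj₁ mid≡bot =
    fwd ((refl , inj₁ refl) , sym mid≡bot) ◅ fwd ((refl , inj₂ next) , trans mid≡bot eq) ◅ ε
  ... | inj₂ mid≡top =
    fwd ((refl , inj₂ next) , trans eq (sym mid≡top)) ◅ fwd ((refl , inj₁ refl) , mid≡top) ◅ ε
  tile-step (zero , _)     (zero , _)     ((() , _) , _)
  tile-step (suc zero , _) (zero , _)     ((() , _) , _)
  tile-step (suc zero , _) (suc zero , _) ((() , _) , _)

  tiles-preserved : ∀ {p q} → SameTile (twoRow top bot) p q →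
    SameTile (threeRow top mid bot) (outerRows p) (outerRows q)
  tiles-preserved = EqClosure.gfold (EqClosure.isEquivalence _) outerRows (tile-step _ _)

mainTheorem18 : (n : ℕ) (λ′ μ : Fin n → ℚ) → IsGT (twoRow λ′ μ) →
    (t : ℚ) → ∣ μ ∣ᵥ ≤ t → t ≤ ∣ λ′ ∣ᵥ →
    Σ (Fin n → ℚ) (λ ν →
      ∣ ν ∣ᵥ ≡ t × IsGT (threeRow λ′ ν μ) ×
      ((i j : Fin n) →
        SameTile (twoRow λ′ μ) (suc zero , i) (zero , j) →
        SameTile (threeRow λ′ ν μ) (suc (suc zero) , i) (zero , j)))
mainTheorem18 n λ′ μ gt t lo hi =
  let (ν , sum , between , sat) = interpolate n μ λ′ (TwoRow.bot≤top gt) t lo hi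
  in ν , sum , threeRow-IsGT gt between , λ i j → Tiles.tiles-preserved between sat
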